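{- Let $\mathsf{DDA}$ be the class of discriminator decomposition algebras. Then (1) $\mathsf{DDA}$ is closed under taking subalgebras, homomorphic images and ultraproducts; (2) $\mathsf{DDA}$ is not closed under direct products, and thus it is neither a variety nor a quasivariety.
   Context: A discriminator decomposition algebra is a structure $\langle B,f,g\rangle$ where $B$ is a Boolean algebra and $f,g$ are modal operators on $B$ (maps with $f(0)=0$, $f(x+y)=f(x)+f(y)$) such that $f(x)+g(x)=1$ for all $x\neq0$. -}

module Defs where

open import Level using (Level; _⊔_; suc)
open import Data.Product using (_×_; _,_; proj₁; proj₂; Σ; ∃)
open import Data.Sum using (_⊎_)
open import Relation.Nullary using (¬_)
open import Relation.Unary using (Pred)
open import Algebra.Lattice.Bundles using (BooleanAlgebra)

record IsModalOp {c ℓ} (B : BooleanAlgebra c ℓ)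
                 (h : BooleanAlgebra.Carrier B → BooleanAlgebra.Carrier B)
                 : Set (c ⊔ ℓ) where
  open BooleanAlgebra B
  field
    cong  : ∀ {x y} → x ≈ y → h x ≈ h y
    pres-⊥ : h ⊥ ≈ ⊥
    pres-∨ : ∀ x y → h (x ∨ y) ≈ h x ∨ h y

record BAO2 (c ℓ : Level) : Set (suc (c ⊔ ℓ)) where
  field
    BA : BooleanAlgebra c ℓ
  open BooleanAlgebra BA public
  field
    f g : Carrier → Carrier
    f-modal : IsModalOp BA f
    g-modal : IsModalOp BA g

IsDDA : ∀ {c ℓ} → BAO2 c ℓ → Set (c ⊔ ℓ)
IsDDA A = ∀ x → ¬ (x A.≈ A.⊥) → (A.f x A.∨ A.g x) A.≈ A.⊤
  where module A = BAO2 A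

record Hom {a ℓa b ℓb} (A : BAO2 a ℓa) (B : BAO2 b ℓb)
           : Set (a ⊔ ℓa ⊔ b ⊔ ℓb) where
  private
    module A = BAO2 A
    module B = BAO2 B
  field
    ⟦_⟧    : A.Carrier → B.Carrier
    cong   : ∀ {x y} → x A.≈ y → ⟦ x ⟧ B.≈ ⟦ y ⟧
    pres-∨ : ∀ x y → ⟦ x A.∨ y ⟧ B.≈ (⟦ x ⟧ B.∨ ⟦ y ⟧)
    pres-∧ : ∀ x y → ⟦ x A.∧ y ⟧ B.≈ (⟦ x ⟧ B.∧ ⟦ y ⟧)
    pres-¬ : ∀ x → ⟦ A.¬ x ⟧ B.≈ (B.¬ ⟦ x ⟧)
    pres-⊤ : ⟦ A.⊤ ⟧ B.≈ B.⊤
    pres-⊥ : ⟦ A.⊥ ⟧ B.≈ B.⊥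
    pres-f : ∀ x → ⟦ A.f x ⟧ B.≈ B.f ⟦ x ⟧
    pres-g : ∀ x → ⟦ A.g x ⟧ B.≈ B.g ⟦ x ⟧

-- embedding (A is isomorphic to a subalgebra of B)
Injective : ∀ {a ℓa b ℓb} {A : BAO2 a ℓa} {B : BAO2 b ℓb} → Hom A B → Set (a ⊔ ℓa ⊔ ℓb)
Injective {A = A} {B} h = ∀ {x y} → ⟦ x ⟧ B.≈ ⟦ y ⟧ → x A.≈ y
  where open Hom h
        module A = BAO2 A
        module B = BAO2 B

-- surjective homomorphism (B is a homomorphic image of A)
Surjective : ∀ {a ℓa b ℓb} {A : BAO2 a ℓa} {B : BAO2 b ℓb} → Hom A B → Set (a ⊔ b ⊔ ℓb)
Surjective {A = A} {B} h = ∀ y → ∃ λ x → ⟦ x ⟧ B.≈ y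
  where open Hom h
        module A = BAO2 A
        module B = BAO2 B

Π : ∀ {i c ℓ} (I : Set i) → (I → BAO2 c ℓ) → BAO2 (i ⊔ c) (i ⊔ ℓ)
Π I A = record
  { BA = record
    { Carrier = (k : I) → C k
    ; _≈_ = λ x y → ∀ k → EQ k (x k) (y k)
    ; _∨_ = λ x y k → BAO2._∨_ (A k) (x k) (y k)
    ; _∧_ = λ x y k → BAO2._∧_ (A k) (x k) (y k)
    ; ¬_  = λ x k → BAO2.¬_ (A k) (x k)
    ; ⊤   = λ k → BAO2.⊤ (A k)
    ; ⊥   = λ k → BAO2.⊥ (A k)
    ; isBooleanAlgebra = record
      { isDistributiveLattice = record
        { isLattice = record
          { isEquivalence = record
            { refl  = λ {x} k → BAO2.refl (A k)
            ; sym   = λ p k → BAO2.sym (A k) (p k)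
            ; trans = λ p q k → BAO2.trans (A k) (p k) (q k) }
          ; ∨-comm  = λ x y k → BAO2.∨-comm (A k) (x k) (y k)
          ; ∨-assoc = λ x y z k → BAO2.∨-assoc (A k) (x k) (y k) (z k)
          ; ∨-cong  = λ p q k → BAO2.∨-cong (A k) (p k) (q k)
          ; ∧-comm  = λ x y k → BAO2.∧-comm (A k) (x k) (y k)
          ; ∧-assoc = λ x y z k → BAO2.∧-assoc (A k) (x k) (y k) (z k)
          ; ∧-cong  = λ p q k → BAO2.∧-cong (A k) (p k) (q k)
          ; absorptive = (λ x y k → proj₁ (BAO2.absorptive (A k)) (x k) (y k))
                       , (λ x y k → proj₂ (BAO2.absorptive (A k)) (x k) (y k)) }
        ; ∨-distrib-∧ = (λ x y z k → proj₁ (BAO2.∨-distrib-∧ (A k)) (x k) (y k) (z k))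
                      , (λ x y z k → proj₂ (BAO2.∨-distrib-∧ (A k)) (x k) (y k) (z k))
        ; ∧-distrib-∨ = (λ x y z k → proj₁ (BAO2.∧-distrib-∨ (A k)) (x k) (y k) (z k))
                      , (λ x y z k → proj₂ (BAO2.∧-distrib-∨ (A k)) (x k) (y k) (z k)) }
      ; ∨-complement = (λ x k → proj₁ (BAO2.∨-complement (A k)) (x k))
                     , (λ x k → proj₂ (BAO2.∨-complement (A k)) (x k))
      ; ∧-complement = (λ x k → proj₁ (BAO2.∧-complement (A k)) (x k))
                     , (λ x k → proj₂ (BAO2.∧-complement (A k)) (x k))
      ; ¬-cong = λ p k → BAO2.¬-cong (A k) (p k) } }
  ; f = λ x k → BAO2.f (A k) (x k)
  ; g = λ x k → BAO2.g (A k) (x k)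
  ; f-modal = record
    { cong = λ p k → IsModalOp.cong (BAO2.f-modal (A k)) (p k)
    ; pres-⊥ = λ k → IsModalOp.pres-⊥ (BAO2.f-modal (A k))
    ; pres-∨ = λ x y k → IsModalOp.pres-∨ (BAO2.f-modal (A k)) (x k) (y k) }
  ; g-modal = record
    { cong = λ p k → IsModalOp.cong (BAO2.g-modal (A k)) (p k)
    ; pres-⊥ = λ k → IsModalOp.pres-⊥ (BAO2.g-modal (A k))
    ; pres-∨ = λ x y k → IsModalOp.pres-∨ (BAO2.g-modal (A k)) (x k) (y k) } }
  where
    C : I → Set _
    C k = BAO2.Carrier (A k)
    EQ : (k : I) → C k → C k → Set _
    EQ k = BAO2._≈_ (A k)

record IsUltrafilter {i ℓ u} (I : Set i) (U : Pred (Pred I ℓ) u)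
                     : Set (i ⊔ suc ℓ ⊔ u) where
  field
    full   : ∀ (P : Pred I ℓ) → (∀ k → P k) → U P
    upward : ∀ {P Q : Pred I ℓ} → (∀ k → P k → Q k) → U P → U Q
    meet   : ∀ {P Q : Pred I ℓ} → U P → U Q → U (λ k → P k × Q k)
    proper : ∀ (P : Pred I ℓ) → (∀ k → ¬ P k) → ¬ U P
    ultra  : ∀ (P : Pred I ℓ) → U P ⊎ U (λ k → ¬ P k)

Ultraproduct : ∀ {i c ℓ u} (I : Set i) (A : I → BAO2 c ℓ)
               (U : Pred (Pred I ℓ) u) → IsUltrafilter I U → BAO2 (i ⊔ c) u
Ultraproduct I A U UF = record
  { BA = record
    { Carrier = (k : I) → C k
    ; _≈_ = _~_
    ; _∨_ = λ x y k → BAO2._∨_ (A k) (x k) (y k)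
    ; _∧_ = λ x y k → BAO2._∧_ (A k) (x k) (y k)
    ; ¬_  = λ x k → BAO2.¬_ (A k) (x k)
    ; ⊤   = λ k → BAO2.⊤ (A k)
    ; ⊥   = λ k → BAO2.⊥ (A k)
    ; isBooleanAlgebra = record
      { isDistributiveLattice = record
        { isLattice = record
          { isEquivalence = record
            { refl  = λ {x} → full _ (λ k → BAO2.refl (A k))
            ; sym   = upward (λ k → BAO2.sym (A k))
            ; trans = λ p q → upward (λ k r → BAO2.trans (A k) (proj₁ r) (proj₂ r)) (meet p q) }
          ; ∨-comm  = λ x y → full _ λ k → BAO2.∨-comm (A k) (x k) (y k)
          ; ∨-assoc = λ x y z → full _ λ k → BAO2.∨-assoc (A k) (x k) (y k) (z k)
          ; ∨-cong  = λ p q → upward (λ k r → BAO2.∨-cong (A k) (proj₁ r) (proj₂ r)) (meet p q)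
          ; ∧-comm  = λ x y → full _ λ k → BAO2.∧-comm (A k) (x k) (y k)
          ; ∧-assoc = λ x y z → full _ λ k → BAO2.∧-assoc (A k) (x k) (y k) (z k)
          ; ∧-cong  = λ p q → upward (λ k r → BAO2.∧-cong (A k) (proj₁ r) (proj₂ r)) (meet p q)
          ; absorptive = (λ x y → full _ λ k → proj₁ (BAO2.absorptive (A k)) (x k) (y k))
                       , (λ x y → full _ λ k → proj₂ (BAO2.absorptive (A k)) (x k) (y k)) }
        ; ∨-distrib-∧ = (λ x y z → full _ λ k → proj₁ (BAO2.∨-distrib-∧ (A k)) (x k) (y k) (z k))
                      , (λ x y z → full _ λ k → proj₂ (BAO2.∨-distrib-∧ (A k)) (x k) (y k) (z k))
        ; ∧-distrib-∨ = (λ x y z → full _ λ k → proj₁ (BAO2.∧-distrib-∨ (A k)) (x k) (y k) (z k))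
                      , (λ x y z → full _ λ k → proj₂ (BAO2.∧-distrib-∨ (A k)) (x k) (y k) (z k)) }
      ; ∨-complement = (λ x → full _ λ k → proj₁ (BAO2.∨-complement (A k)) (x k))
                     , (λ x → full _ λ k → proj₂ (BAO2.∨-complement (A k)) (x k))
      ; ∧-complement = (λ x → full _ λ k → proj₁ (BAO2.∧-complement (A k)) (x k))
                     , (λ x → full _ λ k → proj₂ (BAO2.∧-complement (A k)) (x k))
      ; ¬-cong = upward (λ k → BAO2.¬-cong (A k)) } }
  ; f = λ x k → BAO2.f (A k) (x k)
  ; g = λ x k → BAO2.g (A k) (x k)
  ; f-modal = record
    { cong = upward (λ k → IsModalOp.cong (BAO2.f-modal (A k)))
    ; pres-⊥ = full _ λ k → IsModalOp.pres-⊥ (BAO2.f-modal (A k))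
    ; pres-∨ = λ x y → full _ λ k → IsModalOp.pres-∨ (BAO2.f-modal (A k)) (x k) (y k) }
  ; g-modal = record
    { cong = upward (λ k → IsModalOp.cong (BAO2.g-modal (A k)))
    ; pres-⊥ = full _ λ k → IsModalOp.pres-⊥ (BAO2.g-modal (A k))
    ; pres-∨ = λ x y → full _ λ k → IsModalOp.pres-∨ (BAO2.g-modal (A k)) (x k) (y k) } }
  where
    open IsUltrafilter UF
    C : I → Set _
    C k = BAO2.Carrier (A k)
    _~_ : ((k : I) → C k) → ((k : I) → C k) → Set _
    x ~ y = U (λ k → BAO2._≈_ (A k) (x k) (y k))

{-# OPTIONS --safe #-}
-- Subalgebras and homomorphic images inherit the DDA law because a
-- homomorphism commutes with f x ∨ g x and, when injective, reflects
-- x ≈ 0; for images one pulls back a preimage, which is nonzero. In an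
-- ultraproduct, x ≉ 0 means {k | x k ≈ 0} ∉ U, so by ultrality its
-- complement is in U, and there f x ∨ g x ≈ 1 holds coordinatewise.
-- Products fail since f 0 ∨ g 0 = 0: an element that is 1 at one
-- coordinate and 0 at another is nonzero, yet f x ∨ g x is 0 at the
-- second coordinate.
module Submission where

open import Defs
open import Level using (Level; 0ℓ)
open import Data.Product using (_×_; Σ; _,_)
open import Data.Sum using (inj₁; inj₂)
open import Data.Bool using (Bool; true; false)
open import Data.Bool.Properties using (∨-∧-booleanAlgebra) renaming (_≟_ to _≟𝔹_)
open import Data.Empty using (⊥-elim)
open import Relation.Nullary using (¬_; yes; no)
open import Relation.Unary using (Pred)
open import Relation.Binary.Definitions using (DecidableEquality)
open import Relation.Binary.PropositionalEquality as ≡ using (_≡_; _≢_; refl)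
import Algebra.Lattice.Properties.BooleanAlgebra as BooleanAlgebraProperties
import Relation.Binary.Reasoning.Setoid as SetoidReasoning

module HomProperties {a ℓa b ℓb} {A : BAO2 a ℓa} {B : BAO2 b ℓb} (h : Hom A B) where
  private
    module A = BAO2 A
    module B = BAO2 B
  open Hom h
  open SetoidReasoning B.setoid

  pres-f∨g : ∀ x → ⟦ A.f x A.∨ A.g x ⟧ B.≈ B.f ⟦ x ⟧ B.∨ B.g ⟦ x ⟧
  pres-f∨g x = begin
    ⟦ A.f x A.∨ A.g x ⟧       ≈⟨ pres-∨ (A.f x) (A.g x) ⟩
    ⟦ A.f x ⟧ B.∨ ⟦ A.g x ⟧   ≈⟨ B.∨-cong (pres-f x) (pres-g x) ⟩
    B.f ⟦ x ⟧ B.∨ B.g ⟦ x ⟧   ∎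

  Injective⇒reflects-⊥ : Injective h → ∀ {x} → ⟦ x ⟧ B.≈ B.⊥ → x A.≈ A.⊥
  Injective⇒reflects-⊥ inj hx≈⊥ = inj (B.trans hx≈⊥ (B.sym pres-⊥))

  embedding-reflects-IsDDA : Injective h → IsDDA B → IsDDA A
  embedding-reflects-IsDDA inj ddaB x x≉⊥ = inj (begin
    ⟦ A.f x A.∨ A.g x ⟧       ≈⟨ pres-f∨g x ⟩
    B.f ⟦ x ⟧ B.∨ B.g ⟦ x ⟧   ≈⟨ ddaB ⟦ x ⟧ (λ hx≈⊥ → x≉⊥ (Injective⇒reflects-⊥ inj hx≈⊥)) ⟩
    B.⊤                       ≈⟨ pres-⊤ ⟨
    ⟦ A.⊤ ⟧                   ∎)

  surjection-preserves-IsDDA : Surjective h → IsDDA A → IsDDA B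
  surjection-preserves-IsDDA surj ddaA y y≉⊥ with surj y
  ... | x , hx≈y = begin
    B.f y B.∨ B.g y           ≈⟨ B.∨-cong (f-cong hx≈y) (g-cong hx≈y) ⟨
    B.f ⟦ x ⟧ B.∨ B.g ⟦ x ⟧   ≈⟨ pres-f∨g x ⟨
    ⟦ A.f x A.∨ A.g x ⟧       ≈⟨ cong (ddaA x x≉⊥) ⟩
    ⟦ A.⊤ ⟧                   ≈⟨ pres-⊤ ⟩
    B.⊤                       ∎
    where
    f-cong = IsModalOp.cong B.f-modal
    g-cong = IsModalOp.cong B.g-modal

    x≉⊥ : ¬ (x A.≈ A.⊥)
    x≉⊥ x≈⊥ = y≉⊥ (begin
      y        ≈⟨ hx≈y ⟨
      ⟦ x ⟧    ≈⟨ cong x≈⊥ ⟩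
      ⟦ A.⊥ ⟧  ≈⟨ pres-⊥ ⟩
      B.⊥      ∎)

open HomProperties using (embedding-reflects-IsDDA; surjection-preserves-IsDDA)

ultraproduct-preserves-IsDDA : ∀ {i c ℓ u} (I : Set i) (A : I → BAO2 c ℓ)
  (U : Pred (Pred I ℓ) u) (UF : IsUltrafilter I U) →
  (∀ k → IsDDA (A k)) → IsDDA (Ultraproduct I A U UF)
ultraproduct-preserves-IsDDA I A U UF ddaA x x≉⊥
  with IsUltrafilter.ultra UF (λ k → BAO2._≈_ (A k) (x k) (BAO2.⊥ (A k)))
... | inj₁ x≈⊥ = ⊥-elim (x≉⊥ x≈⊥)
... | inj₂ x≉⊥-U-almost-everywhere = IsUltrafilter.upward UF (λ k → ddaA k (x k)) x≉⊥-U-almost-everywhere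

module _ {c ℓ} (A : BAO2 c ℓ) where
  open BAO2 A hiding (¬_)
  open SetoidReasoning setoid

  Nontrivial : Set ℓ
  Nontrivial = ¬ (⊤ ≈ ⊥)

  f⊥∨g⊥≈⊥ : f ⊥ ∨ g ⊥ ≈ ⊥
  f⊥∨g⊥≈⊥ = begin
    f ⊥ ∨ g ⊥  ≈⟨ ∨-cong (IsModalOp.pres-⊥ f-modal) (IsModalOp.pres-⊥ g-modal) ⟩
    ⊥ ∨ ⊥      ≈⟨ BooleanAlgebraProperties.∨-idem BA ⊥ ⟩
    ⊥          ∎

module _ {i c ℓ} {I : Set i} (_≟_ : DecidableEquality I) (A : I → BAO2 c ℓ) where
  private
    module A k = BAO2 (A k)

  indicator : I → (k : I) → A.Carrier k
  indicator k₀ k with k₀ ≟ k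
  ... | yes _ = A.⊤ k
  ... | no _  = A.⊥ k

  indicator-≡ : ∀ k₀ → indicator k₀ k₀ ≡ A.⊤ k₀
  indicator-≡ k₀ with k₀ ≟ k₀
  ... | yes _    = refl
  ... | no k₀≢k₀ = ⊥-elim (k₀≢k₀ refl)

  indicator-≢ : ∀ {k₀ k₁} → k₀ ≢ k₁ → indicator k₀ k₁ ≡ A.⊥ k₁
  indicator-≢ {k₀} {k₁} k₀≢k₁ with k₀ ≟ k₁
  ... | yes k₀≡k₁ = ⊥-elim (k₀≢k₁ k₀≡k₁)
  ... | no _      = refl

  Π-¬IsDDA : (∀ k → Nontrivial (A k)) → ∀ {k₀ k₁} → k₀ ≢ k₁ → ¬ IsDDA (Π I A)
  Π-¬IsDDA nontrivial {k₀} {k₁} k₀≢k₁ dda = nontrivial k₁ (begin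
    K₁.⊤                                  ≈⟨ dda (indicator k₀) indicator≉⊥ k₁ ⟨
    K₁.f (indicator k₀ k₁) K₁.∨ K₁.g (indicator k₀ k₁)
      ≡⟨ ≡.cong (λ z → K₁.f z K₁.∨ K₁.g z) (indicator-≢ k₀≢k₁) ⟩
    K₁.f K₁.⊥ K₁.∨ K₁.g K₁.⊥              ≈⟨ f⊥∨g⊥≈⊥ (A k₁) ⟩
    K₁.⊥                                  ∎)
    where
    module K₁ = BAO2 (A k₁)
    module ΠA = BAO2 (Π I A)
    open SetoidReasoning K₁.setoid

    indicator≉⊥ : ¬ (indicator k₀ ΠA.≈ ΠA.⊥)
    indicator≉⊥ indicator≈⊥ = nontrivial k₀ (BAO2.trans (A k₀)
      (BAO2.reflexive (A k₀) (≡.sym (indicator-≡ k₀))) (indicator≈⊥ k₀))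

𝟚 : BAO2 0ℓ 0ℓ
𝟚 = record
  { BA = ∨-∧-booleanAlgebra
  ; f = λ x → x
  ; g = λ x → x
  ; f-modal = identity-modal
  ; g-modal = identity-modal
  }
  where
  identity-modal : IsModalOp ∨-∧-booleanAlgebra (λ x → x)
  identity-modal = record { cong = λ x≡y → x≡y ; pres-⊥ = refl ; pres-∨ = λ _ _ → refl }

𝟚-isDDA : IsDDA 𝟚
𝟚-isDDA true  _           = refl
𝟚-isDDA false false≢false = ⊥-elim (false≢false refl)

𝟚²-¬IsDDA : ¬ IsDDA (Π Bool (λ _ → 𝟚))
𝟚²-¬IsDDA = Π-¬IsDDA _≟𝔹_ (λ _ → 𝟚) (λ _ ()) {true} {false} (λ ())

mainTheorem10 : ∀ {a ℓa b ℓb i c ℓ u : Level} →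
    -- (1a) closed under subalgebras (embeddings)
    ((A : BAO2 a ℓa) (B : BAO2 b ℓb) (h : Hom A B) →
       Injective h → IsDDA B → IsDDA A)
    -- (1b) closed under homomorphic images
    × ((A : BAO2 a ℓa) (B : BAO2 b ℓb) (h : Hom A B) →
       Surjective h → IsDDA A → IsDDA B)
    -- (1c) closed under ultraproducts
    × ((I : Set i) (A : I → BAO2 c ℓ) (U : Pred (Pred I ℓ) u)
         (UF : IsUltrafilter I U) →
       (∀ k → IsDDA (A k)) → IsDDA (Ultraproduct I A U UF))
    -- (2) not closed under direct products
    × Σ Set (λ I → Σ (I → BAO2 0ℓ 0ℓ) (λ A →
        (∀ k → IsDDA (A k)) × ¬ IsDDA (Π I A)))
mainTheorem10 =
    (λ A B h → embedding-reflects-IsDDA h)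
  , (λ A B h → surjection-preserves-IsDDA h)
  , ultraproduct-preserves-IsDDA
  , Bool , (λ _ → 𝟚) , (λ _ → 𝟚-isDDA) , 𝟚²-¬IsDDA
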